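{- Let $\underline{D}=(D;\sqcap,\sqcup,\neg,\lrcorner,\bot,\top)$ be a pure double Boolean algebra. The following are equivalent: (1) $\underline{D}$ is simple; (2) either ($D_\sqcap=\{\bot\}$ and $|D_\sqcup|\le 2$), or ($\top\sqcap\top=\top$ and the only ideals $J$ of the Boolean algebra $\underline{D}_\sqcap$ with $\neg\lrcorner J\subseteq J$ are $\{\bot\}$ and $D_\sqcap$); (3) either ($D_\sqcup=\{\top\}$ and $|D_\sqcap|\le 2$), or ($\bot\sqcup\bot=\bot$ and the only filters $F$ of the Boolean algebra $\underline{D}_\sqcup$ with $\lrcorner\neg F\subseteq F$ are $\{\top\}$ and $D_\sqcup$).
   Context: A double Boolean algebra (dBa) is an algebra $\underline{D}=(D;\sqcap,\sqcup,\neg,\lrcorner,\bot,\top)$ of type $(2,2,1,1,0,0)$ satisfying, for all $x,y,z$, where $x\vee y:=\neg(\neg x\sqcap\neg y)$ and $x\wedge y:=\lrcorner(\lrcorner x\sqcup\lrcorner y)$: $(x\sqcap x)\sqcap y=x\sqcap y$; $(x\sqcup x)\sqcup y=x\sqcup y$; $\sqcap$ and $\sqcup$ are commutative and associative; $x\sqcap(x\sqcup y)=x\sqcap x$; $x\sqcup(x\sqcap y)=x\sqcup x$; $x\sqcap(x\vee y)=x\sqcap x$; $x\sqcup(x\wedge y)=x\sqcup x$; $x\sqcap(y\vee z)=(x\sqcap y)\vee(x\sqcap z)$; $x\sqcup(y\wedge z)=(x\sqcup y)\wedge(x\sqcup z)$; $\neg\neg(x\sqcap y)=x\sqcap y$;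 $\lrcorner\lrcorner(x\sqcup y)=x\sqcup y$; $\neg(x\sqcap x)=\neg x$; $\lrcorner(x\sqcup x)=\lrcorner x$; $x\sqcap\neg x=\bot$; $x\sqcup\lrcorner x=\top$; $\neg\bot=\top\sqcap\top$; $\lrcorner\top=\bot\sqcup\bot$; $\neg\top=\bot$; $\lrcorner\bot=\top$; $(x\sqcap x)\sqcup(x\sqcap x)=(x\sqcup x)\sqcap(x\sqcup x)$. Let $D_\sqcap=\{x\in D: x\sqcap x=x\}$, $D_\sqcup=\{x\in D: x\sqcup x=x\}$; $\underline{D}$ is pure if $D=D_\sqcap\cup D_\sqcup$. It is known that $\underline{D}_\sqcap=(D_\sqcap;\sqcap,\vee,\neg,\bot,\neg\bot)$ and $\underline{D}_\sqcup=(D_\sqcup;\wedge,\sqcup,\lrcorner,\lrcorner\top,\top)$ are Boolean algebras; ideals and filters are meant in these Boolean algebras. For $A\subseteq D$, $\neg A=\{\neg a:a\in A\}$, $\lrcorner A=\{\lrcorner a: a\in A\}$. Simple means the only congruences (equivalence relations compatible with all operations) are $\Delta_D$ and $D\times D$. -}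

module Defs where

open import Level using (0ℓ) renaming (suc to lsuc)
open import Data.Product using (Σ; ∃; _×_; _,_)
open import Data.Sum using (_⊎_)
open import Relation.Binary.PropositionalEquality using (_≡_)
open import Relation.Binary.Definitions using (Reflexive; Symmetric; Transitive)


record DBA : Set₁ where
  field
    Carrier : Set
    _⊓_ _⊔_ : Carrier → Carrier → Carrier
    ¬_ ⌟_   : Carrier → Carrier
    ⊥ ⊤     : Carrier

  infixr 7 _⊓_
  infixr 6 _⊔_

  _∨_ : Carrier → Carrier → Carrier
  x ∨ y = ¬ ((¬ x) ⊓ (¬ y))

  _∧_ : Carrier → Carrier → Carrier
  x ∧ y = ⌟ ((⌟ x) ⊔ (⌟ y))

  field
    ⊓-idem-l  : ∀ x y → (x ⊓ x) ⊓ y ≡ x ⊓ y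
    ⊔-idem-l  : ∀ x y → (x ⊔ x) ⊔ y ≡ x ⊔ y
    ⊓-comm    : ∀ x y → x ⊓ y ≡ y ⊓ x
    ⊔-comm    : ∀ x y → x ⊔ y ≡ y ⊔ x
    ⊓-assoc   : ∀ x y z → x ⊓ (y ⊓ z) ≡ (x ⊓ y) ⊓ z
    ⊔-assoc   : ∀ x y z → x ⊔ (y ⊔ z) ≡ (x ⊔ y) ⊔ z
    ⊓-abs-⊔   : ∀ x y → x ⊓ (x ⊔ y) ≡ x ⊓ x
    ⊔-abs-⊓   : ∀ x y → x ⊔ (x ⊓ y) ≡ x ⊔ x
    ⊓-abs-∨   : ∀ x y → x ⊓ (x ∨ y) ≡ x ⊓ x
    ⊔-abs-∧   : ∀ x y → x ⊔ (x ∧ y) ≡ x ⊔ x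
    ⊓-distr-∨ : ∀ x y z → x ⊓ (y ∨ z) ≡ (x ⊓ y) ∨ (x ⊓ z)
    ⊔-distr-∧ : ∀ x y z → x ⊔ (y ∧ z) ≡ (x ⊔ y) ∧ (x ⊔ z)
    ¬¬-⊓      : ∀ x y → ¬ (¬ (x ⊓ y)) ≡ x ⊓ y
    ⌟⌟-⊔      : ∀ x y → ⌟ (⌟ (x ⊔ y)) ≡ x ⊔ y
    ¬-⊓-idem  : ∀ x → ¬ (x ⊓ x) ≡ ¬ x
    ⌟-⊔-idem  : ∀ x → ⌟ (x ⊔ x) ≡ ⌟ x
    ⊓-compl   : ∀ x → x ⊓ (¬ x) ≡ ⊥
    ⊔-compl   : ∀ x → x ⊔ (⌟ x) ≡ ⊤
    ¬⊥        : ¬ ⊥ ≡ ⊤ ⊓ ⊤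
    ⌟⊤        : ⌟ ⊤ ≡ ⊥ ⊔ ⊥
    ¬⊤        : ¬ ⊤ ≡ ⊥
    ⌟⊥        : ⌟ ⊥ ≡ ⊤
    mixed     : ∀ x → (x ⊓ x) ⊔ (x ⊓ x) ≡ (x ⊔ x) ⊓ (x ⊔ x)

module _ (𝔻 : DBA) where
  open DBA 𝔻

  D⊓ : Carrier → Set
  D⊓ x = x ⊓ x ≡ x

  D⊔ : Carrier → Set
  D⊔ x = x ⊔ x ≡ x

  Pure : Set
  Pure = ∀ x → D⊓ x ⊎ D⊔ x

  -- congruence: equivalence relation compatible with all operations
  -- (compatibility with the nullary operations is automatic)
  record IsCongruence (θ : Carrier → Carrier → Set) : Set where
    field
      refl  : Reflexive θ
      sym   : Symmetric θ
      trans : Transitive θ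
      ⊓-cong : ∀ {x x' y y'} → θ x x' → θ y y' → θ (x ⊓ y) (x' ⊓ y')
      ⊔-cong : ∀ {x x' y y'} → θ x x' → θ y y' → θ (x ⊔ y) (x' ⊔ y')
      ¬-cong : ∀ {x x'} → θ x x' → θ (¬ x) (¬ x')
      ⌟-cong : ∀ {x x'} → θ x x' → θ (⌟ x) (⌟ x')

  Simple : Set₁
  Simple = ∀ (θ : Carrier → Carrier → Set) → IsCongruence θ →
           (∀ x y → θ x y → x ≡ y) ⊎ (∀ x y → θ x y)

  -- ideal of the Boolean algebra (D_⊓; ⊓, ∨, ¬, ⊥, ¬⊥); order y ≤ x iff y ⊓ x = y
  record IsIdeal⊓ (J : Carrier → Set) : Set where
    field
      ⊆D⊓     : ∀ x → J x → D⊓ x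
      ⊥∈      : J ⊥
      ∨-closed : ∀ x y → J x → J y → J (x ∨ y)
      downward : ∀ x y → J x → D⊓ y → y ⊓ x ≡ y → J y

  -- filter of the Boolean algebra (D_⊔; ∧, ⊔, ⌟, ⌟⊤, ⊤); order x ≤ y iff x ⊔ y = y
  record IsFilter⊔ (F : Carrier → Set) : Set where
    field
      ⊆D⊔     : ∀ x → F x → D⊔ x
      ⊤∈      : F ⊤
      ∧-closed : ∀ x y → F x → F y → F (x ∧ y)
      upward   : ∀ x y → F x → D⊔ y → x ⊔ y ≡ y → F y

  D⊓-is-⊥ : Set
  D⊓-is-⊥ = D⊓ ⊥ × (∀ x → D⊓ x → x ≡ ⊥)

  D⊔-is-⊤ : Set
  D⊔-is-⊤ = D⊔ ⊤ × (∀ x → D⊔ x → x ≡ ⊤)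

  D⊔-atMost2 : Set
  D⊔-atMost2 = Σ Carrier λ a → Σ Carrier λ b → ∀ x → D⊔ x → x ≡ a ⊎ x ≡ b

  D⊓-atMost2 : Set
  D⊓-atMost2 = Σ Carrier λ a → Σ Carrier λ b → ∀ x → D⊓ x → x ≡ a ⊎ x ≡ b

  OnlyTrivialIdeals : Set₁
  OnlyTrivialIdeals = ∀ (J : Carrier → Set) → IsIdeal⊓ J →
    (∀ a → J a → J (¬ (⌟ a))) →
    (∀ x → J x → x ≡ ⊥) ⊎ (∀ x → D⊓ x → J x)

  OnlyTrivialFilters : Set₁
  OnlyTrivialFilters = ∀ (F : Carrier → Set) → IsFilter⊔ F →
    (∀ a → F a → F (⌟ (¬ a))) →
    (∀ x → F x → x ≡ ⊤) ⊎ (∀ x → D⊔ x → F x)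

  Cond2 : Set₁
  Cond2 = (D⊓-is-⊥ × D⊔-atMost2) ⊎ ((⊤ ⊓ ⊤ ≡ ⊤) × OnlyTrivialIdeals)

  Cond3 : Set₁
  Cond3 = (D⊔-is-⊤ × D⊓-atMost2) ⊎ ((⊥ ⊔ ⊥ ≡ ⊥) × OnlyTrivialFilters)

-- For an ideal J of D_⊓ closed under ¬⌟, the relation "x ∨ j = y ∨ j and x ⊔ j = y ⊔ j for
-- some j ∈ J" is a congruence Θ whose ⊥-class in D_⊓ is J, so a simple dBA has only trivial such
-- ideals. Conversely, the ⊥-class in D_⊓ of a congruence θ is such an ideal. If it is all of D_⊓
-- then ⊤ θ ⊥ and θ is total; if it is {⊥} then θ is injective on D_⊓ and, since ⊤ ∈ D_⊓, on D_⊔,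
-- and in a pure dBA x is determined by x ⊓ x and x ⊔ x. If ⊤ ∉ D_⊓, the congruence Θ for J = D_⊓
-- cannot be total, which forces D_⊓ = {⊥}; then all principal filters of D_⊔ are ⌟¬-closed, hence
-- trivial. Condition (3) is condition (2) for the dual algebra, which swaps ⊓ with ⊔ and ¬ with ⌟.

module Submission where

open import Defs
open import Level using (0ℓ) renaming (suc to lsuc)
open import Data.Product using (_×_; _,_; Σ; proj₁; proj₂)
open import Data.Sum as Sum using (_⊎_; inj₁; inj₂; swap)
open import Function.Bundles using (_⇔_; mk⇔)
open import Axiom.ExcludedMiddle using (ExcludedMiddle)
open import Relation.Nullary using (Dec; yes; no)
open import Relation.Nullary.Negation using (contradiction)
open import Relation.Binary.PropositionalEquality
  using (_≡_; _≢_; refl; sym; trans; cong; cong₂; subst; subst₂; module ≡-Reasoning)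

dual : DBA → DBA
dual 𝔻 = record
  { Carrier = Carrier ; _⊓_ = _⊔_ ; _⊔_ = _⊓_ ; ¬_ = ⌟_ ; ⌟_ = ¬_ ; ⊥ = ⊤ ; ⊤ = ⊥
  ; ⊓-idem-l = ⊔-idem-l ; ⊔-idem-l = ⊓-idem-l ; ⊓-comm = ⊔-comm ; ⊔-comm = ⊓-comm
  ; ⊓-assoc = ⊔-assoc ; ⊔-assoc = ⊓-assoc ; ⊓-abs-⊔ = ⊔-abs-⊓ ; ⊔-abs-⊓ = ⊓-abs-⊔
  ; ⊓-abs-∨ = ⊔-abs-∧ ; ⊔-abs-∧ = ⊓-abs-∨ ; ⊓-distr-∨ = ⊔-distr-∧ ; ⊔-distr-∧ = ⊓-distr-∨
  ; ¬¬-⊓ = ⌟⌟-⊔ ; ⌟⌟-⊔ = ¬¬-⊓ ; ¬-⊓-idem = ⌟-⊔-idem ; ⌟-⊔-idem = ¬-⊓-idem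
  ; ⊓-compl = ⊔-compl ; ⊔-compl = ⊓-compl ; ¬⊥ = ⌟⊤ ; ⌟⊤ = ¬⊥ ; ¬⊤ = ⌟⊥ ; ⌟⊥ = ¬⊤
  ; mixed = λ x → sym (mixed x) }
  where open DBA 𝔻

module Properties (𝔻 : DBA) where
  open DBA 𝔻
  open ≡-Reasoning

  ⊓-idem-r : ∀ x y → x ⊓ (y ⊓ y) ≡ x ⊓ y
  ⊓-idem-r x y = begin
    x ⊓ (y ⊓ y)   ≡⟨ ⊓-comm x (y ⊓ y) ⟩
    (y ⊓ y) ⊓ x   ≡⟨ ⊓-idem-l y x ⟩
    y ⊓ x         ≡⟨ ⊓-comm y x ⟩
    x ⊓ y         ∎

  ⊓-repeat : ∀ x y → y ⊓ (x ⊓ y) ≡ x ⊓ y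
  ⊓-repeat x y = begin
    y ⊓ (x ⊓ y)   ≡⟨ cong (y ⊓_) (⊓-comm x y) ⟩
    y ⊓ (y ⊓ x)   ≡⟨ ⊓-assoc y y x ⟩
    (y ⊓ y) ⊓ x   ≡⟨ ⊓-idem-l y x ⟩
    y ⊓ x         ≡⟨ ⊓-comm y x ⟩
    x ⊓ y         ∎

  ⊓-D⊓ : ∀ x y → D⊓ 𝔻 (x ⊓ y)
  ⊓-D⊓ x y = begin
    (x ⊓ y) ⊓ (x ⊓ y)   ≡⟨ ⊓-assoc x y (x ⊓ y) ⟨
    x ⊓ (y ⊓ (x ⊓ y))   ≡⟨ cong (x ⊓_) (⊓-repeat x y) ⟩
    x ⊓ (x ⊓ y)         ≡⟨ ⊓-assoc x x y ⟩
    (x ⊓ x) ⊓ y         ≡⟨ ⊓-idem-l x y ⟩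
    x ⊓ y               ∎

  ⊓-distribʳ-⊓ : ∀ x y z → (x ⊓ y) ⊓ z ≡ (x ⊓ z) ⊓ (y ⊓ z)
  ⊓-distribʳ-⊓ x y z = sym (begin
    (x ⊓ z) ⊓ (y ⊓ z)   ≡⟨ ⊓-assoc x z (y ⊓ z) ⟨
    x ⊓ (z ⊓ (y ⊓ z))   ≡⟨ cong (x ⊓_) (⊓-repeat y z) ⟩
    x ⊓ (y ⊓ z)         ≡⟨ ⊓-assoc x y z ⟩
    (x ⊓ y) ⊓ z         ∎)

  ¬¬x≡x⊓x : ∀ x → ¬ (¬ x) ≡ x ⊓ x
  ¬¬x≡x⊓x x = trans (cong ¬_ (sym (¬-⊓-idem x))) (¬¬-⊓ x x)

  ¬-D⊓ : ∀ x → D⊓ 𝔻 (¬ x)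
  ¬-D⊓ x = begin
    ¬ x ⊓ ¬ x     ≡⟨ ¬¬x≡x⊓x (¬ x) ⟨
    ¬ (¬ (¬ x))   ≡⟨ cong ¬_ (¬¬x≡x⊓x x) ⟩
    ¬ (x ⊓ x)     ≡⟨ ¬-⊓-idem x ⟩
    ¬ x           ∎

  ∨-D⊓ : ∀ x y → D⊓ 𝔻 (x ∨ y)
  ∨-D⊓ x y = ¬-D⊓ _

  ⊥-D⊓ : D⊓ 𝔻 ⊥
  ⊥-D⊓ = subst (D⊓ 𝔻) ¬⊤ (¬-D⊓ ⊤)

  ⊓-zeroʳ : ∀ x → x ⊓ ⊥ ≡ ⊥
  ⊓-zeroʳ x = begin
    x ⊓ ⊥           ≡⟨ cong (x ⊓_) (⊓-compl x) ⟨
    x ⊓ (x ⊓ ¬ x)   ≡⟨ ⊓-assoc x x (¬ x) ⟩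
    (x ⊓ x) ⊓ ¬ x   ≡⟨ ⊓-idem-l x (¬ x) ⟩
    x ⊓ ¬ x         ≡⟨ ⊓-compl x ⟩
    ⊥               ∎

  ∨-comm : ∀ x y → x ∨ y ≡ y ∨ x
  ∨-comm x y = cong ¬_ (⊓-comm (¬ x) (¬ y))

  ∨-assoc : ∀ x y z → x ∨ (y ∨ z) ≡ (x ∨ y) ∨ z
  ∨-assoc x y z = cong ¬_ (begin
    ¬ x ⊓ ¬ (y ∨ z)     ≡⟨ cong (¬ x ⊓_) (¬¬-⊓ (¬ y) (¬ z)) ⟩
    ¬ x ⊓ (¬ y ⊓ ¬ z)   ≡⟨ ⊓-assoc (¬ x) (¬ y) (¬ z) ⟩
    (¬ x ⊓ ¬ y) ⊓ ¬ z   ≡⟨ cong (_⊓ ¬ z) (¬¬-⊓ (¬ x) (¬ y)) ⟨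
    ¬ (x ∨ y) ⊓ ¬ z     ∎)

  ∨-complementʳ : ∀ x → x ∨ (¬ x) ≡ ¬ ⊥
  ∨-complementʳ x = cong ¬_ (begin
    ¬ x ⊓ ¬ (¬ x)   ≡⟨ cong (¬ x ⊓_) (¬¬x≡x⊓x x) ⟩
    ¬ x ⊓ (x ⊓ x)   ≡⟨ ⊓-idem-r (¬ x) x ⟩
    ¬ x ⊓ x         ≡⟨ ⊓-comm (¬ x) x ⟩
    x ⊓ ¬ x         ≡⟨ ⊓-compl x ⟩
    ⊥               ∎)

  ⊓-identityʳ : ∀ x → x ⊓ ¬ ⊥ ≡ x ⊓ x
  ⊓-identityʳ x = trans (cong (x ⊓_) (sym (∨-complementʳ x))) (⊓-abs-∨ x (¬ x))

  ∨-identityʳ : ∀ x → x ∨ ⊥ ≡ x ⊓ x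
  ∨-identityʳ x = trans (cong ¬_ (trans (⊓-identityʳ (¬ x)) (¬-D⊓ x))) (¬¬x≡x⊓x x)

  ∨-identityˡ : ∀ x → ⊥ ∨ x ≡ x ⊓ x
  ∨-identityˡ x = trans (∨-comm ⊥ x) (∨-identityʳ x)

  ∨-idem : ∀ x → x ∨ x ≡ x ⊓ x
  ∨-idem x = trans (cong ¬_ (¬-D⊓ x)) (¬¬x≡x⊓x x)

  ¬-distrib-⊓ : ∀ x y → ¬ (x ⊓ y) ≡ (¬ x) ∨ (¬ y)
  ¬-distrib-⊓ x y = sym (cong ¬_ (begin
    ¬ (¬ x) ⊓ ¬ (¬ y)   ≡⟨ cong₂ _⊓_ (¬¬x≡x⊓x x) (¬¬x≡x⊓x y) ⟩
    (x ⊓ x) ⊓ (y ⊓ y)   ≡⟨ ⊓-idem-l x (y ⊓ y) ⟩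
    x ⊓ (y ⊓ y)         ≡⟨ ⊓-idem-r x y ⟩
    x ⊓ y               ∎))

  ¬⊓-∨-cancel : ∀ j x → ¬ j ⊓ (x ∨ j) ≡ ¬ j ⊓ x
  ¬⊓-∨-cancel j x = begin
    ¬ j ⊓ (x ∨ j)           ≡⟨ ⊓-distr-∨ (¬ j) x j ⟩
    (¬ j ⊓ x) ∨ (¬ j ⊓ j)   ≡⟨ cong ((¬ j ⊓ x) ∨_) (trans (⊓-comm (¬ j) j) (⊓-compl j)) ⟩
    (¬ j ⊓ x) ∨ ⊥           ≡⟨ ∨-identityʳ (¬ j ⊓ x) ⟩
    (¬ j ⊓ x) ⊓ (¬ j ⊓ x)   ≡⟨ ⊓-D⊓ (¬ j) x ⟩
    ¬ j ⊓ x                 ∎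

  ∨-resp-¬ : ∀ {x y j} → x ∨ j ≡ y ∨ j → (¬ x) ∨ j ≡ (¬ y) ∨ j
  ∨-resp-¬ {x} {y} {j} e = begin
    (¬ x) ∨ j           ≡⟨ ¬-∨-via-∨ x ⟩
    ¬ (¬ j ⊓ (x ∨ j))   ≡⟨ cong (λ z → ¬ (¬ j ⊓ z)) e ⟩
    ¬ (¬ j ⊓ (y ∨ j))   ≡⟨ ¬-∨-via-∨ y ⟨
    (¬ y) ∨ j           ∎
    where
    ¬-∨-via-∨ : ∀ a → (¬ a) ∨ j ≡ ¬ (¬ j ⊓ (a ∨ j))
    ¬-∨-via-∨ a = cong ¬_ (begin
      ¬ (¬ a) ⊓ ¬ j   ≡⟨ cong (_⊓ ¬ j) (¬¬x≡x⊓x a) ⟩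
      (a ⊓ a) ⊓ ¬ j   ≡⟨ ⊓-idem-l a (¬ j) ⟩
      a ⊓ ¬ j         ≡⟨ ⊓-comm a (¬ j) ⟩
      ¬ j ⊓ a         ≡⟨ ¬⊓-∨-cancel j a ⟨
      ¬ j ⊓ (a ∨ j)   ∎)

  ∨-resp-⊓ : ∀ {x x′ y y′ j} → x ∨ j ≡ x′ ∨ j → y ∨ j ≡ y′ ∨ j → (x ⊓ y) ∨ j ≡ (x′ ⊓ y′) ∨ j
  ∨-resp-⊓ {x} {x′} {y} {y′} {j} ex ey = begin
    (x ⊓ y) ∨ j                                       ≡⟨ ⊓-∨-via-¬∨ x y ⟩
    ¬ ((¬ j ⊓ ((¬ x) ∨ j)) ∨ (¬ j ⊓ ((¬ y) ∨ j)))     ≡⟨ cong₂ (λ p q → ¬ ((¬ j ⊓ p) ∨ (¬ j ⊓ q))) (∨-resp-¬ ex) (∨-resp-¬ ey) ⟩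
    ¬ ((¬ j ⊓ ((¬ x′) ∨ j)) ∨ (¬ j ⊓ ((¬ y′) ∨ j)))   ≡⟨ ⊓-∨-via-¬∨ x′ y′ ⟨
    (x′ ⊓ y′) ∨ j                                     ∎
    where
    ⊓-∨-via-¬∨ : ∀ a b → (a ⊓ b) ∨ j ≡ ¬ ((¬ j ⊓ ((¬ a) ∨ j)) ∨ (¬ j ⊓ ((¬ b) ∨ j)))
    ⊓-∨-via-¬∨ a b = cong ¬_ (begin
      ¬ (a ⊓ b) ⊓ ¬ j                             ≡⟨ ⊓-comm (¬ (a ⊓ b)) (¬ j) ⟩
      ¬ j ⊓ ¬ (a ⊓ b)                             ≡⟨ cong (¬ j ⊓_) (¬-distrib-⊓ a b) ⟩
      ¬ j ⊓ ((¬ a) ∨ (¬ b))                       ≡⟨ ⊓-distr-∨ (¬ j) (¬ a) (¬ b) ⟩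
      (¬ j ⊓ ¬ a) ∨ (¬ j ⊓ ¬ b)                   ≡⟨ cong₂ _∨_ (¬⊓-∨-cancel j (¬ a)) (¬⊓-∨-cancel j (¬ b)) ⟨
      (¬ j ⊓ ((¬ a) ∨ j)) ∨ (¬ j ⊓ ((¬ b) ∨ j))   ∎)

  widen-∨ˡ : ∀ {x y j k} → x ∨ j ≡ y ∨ j → x ∨ (j ∨ k) ≡ y ∨ (j ∨ k)
  widen-∨ˡ {x} {y} {j} {k} e = begin
    x ∨ (j ∨ k)   ≡⟨ ∨-assoc x j k ⟩
    (x ∨ j) ∨ k   ≡⟨ cong (_∨ k) e ⟩
    (y ∨ j) ∨ k   ≡⟨ ∨-assoc y j k ⟨
    y ∨ (j ∨ k)   ∎

  widen-∨ʳ : ∀ {x y j k} → x ∨ k ≡ y ∨ k → x ∨ (j ∨ k) ≡ y ∨ (j ∨ k)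
  widen-∨ʳ {x} {y} {j} {k} e = begin
    x ∨ (j ∨ k)   ≡⟨ cong (x ∨_) (∨-comm j k) ⟩
    x ∨ (k ∨ j)   ≡⟨ widen-∨ˡ e ⟩
    y ∨ (k ∨ j)   ≡⟨ cong (y ∨_) (∨-comm k j) ⟩
    y ∨ (j ∨ k)   ∎

  ⊓-∨¬-cancel : ∀ a c → (a ⊓ c) ∨ (¬ c) ≡ a ∨ (¬ c)
  ⊓-∨¬-cancel a c = cong ¬_ (begin
    ¬ (a ⊓ c) ⊓ ¬ (¬ c)         ≡⟨ ⊓-comm (¬ (a ⊓ c)) (¬ (¬ c)) ⟩
    ¬ (¬ c) ⊓ ¬ (a ⊓ c)         ≡⟨ cong (¬ (¬ c) ⊓_) (¬-distrib-⊓ a c) ⟩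
    ¬ (¬ c) ⊓ ((¬ a) ∨ (¬ c))   ≡⟨ ¬⊓-∨-cancel (¬ c) (¬ a) ⟩
    ¬ (¬ c) ⊓ ¬ a               ≡⟨ ⊓-comm (¬ (¬ c)) (¬ a) ⟩
    ¬ a ⊓ ¬ (¬ c)               ∎)

  ⊓-agree⇒∨¬-agree : ∀ {a b c} → a ⊓ c ≡ b ⊓ c → a ∨ (¬ c) ≡ b ∨ (¬ c)
  ⊓-agree⇒∨¬-agree {a} {b} {c} e = begin
    a ∨ (¬ c)         ≡⟨ ⊓-∨¬-cancel a c ⟨
    (a ⊓ c) ∨ (¬ c)   ≡⟨ cong (_∨ (¬ c)) e ⟩
    (b ⊓ c) ∨ (¬ c)   ≡⟨ ⊓-∨¬-cancel b c ⟩
    b ∨ (¬ c)         ∎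

  ⊓-resp-¬ : ∀ {a b c} → a ⊓ c ≡ b ⊓ c → ¬ a ⊓ c ≡ ¬ b ⊓ c
  ⊓-resp-¬ {a} {b} {c} e = begin
    ¬ a ⊓ c               ≡⟨ ¬⊓≡¬[⊓∨¬] a ⟩
    ¬ ((a ⊓ c) ∨ (¬ c))   ≡⟨ cong (λ z → ¬ (z ∨ (¬ c))) e ⟩
    ¬ ((b ⊓ c) ∨ (¬ c))   ≡⟨ ¬⊓≡¬[⊓∨¬] b ⟨
    ¬ b ⊓ c               ∎
    where
    ¬⊓≡¬[⊓∨¬] : ∀ x → ¬ x ⊓ c ≡ ¬ ((x ⊓ c) ∨ (¬ c))
    ¬⊓≡¬[⊓∨¬] x = sym (begin
      ¬ ((x ⊓ c) ∨ (¬ c))   ≡⟨ cong ¬_ (⊓-∨¬-cancel x c) ⟩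
      ¬ (x ∨ (¬ c))         ≡⟨ ¬¬-⊓ (¬ x) (¬ (¬ c)) ⟩
      ¬ x ⊓ ¬ (¬ c)         ≡⟨ cong (¬ x ⊓_) (¬¬x≡x⊓x c) ⟩
      ¬ x ⊓ (c ⊓ c)         ≡⟨ ⊓-idem-r (¬ x) c ⟩
      ¬ x ⊓ c               ∎)

  ⊓¬≡⊥⇒⊓≡ : ∀ {a b} → D⊓ 𝔻 a → a ⊓ ¬ b ≡ ⊥ → a ⊓ b ≡ a
  ⊓¬≡⊥⇒⊓≡ {a} {b} a∈D⊓ a⊓¬b≡⊥ = begin
    a ⊓ b                 ≡⟨ ⊓-D⊓ a b ⟨
    (a ⊓ b) ⊓ (a ⊓ b)     ≡⟨ ∨-identityʳ (a ⊓ b) ⟨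
    (a ⊓ b) ∨ ⊥           ≡⟨ cong ((a ⊓ b) ∨_) a⊓¬b≡⊥ ⟨
    (a ⊓ b) ∨ (a ⊓ ¬ b)   ≡⟨ ⊓-distr-∨ a b (¬ b) ⟨
    a ⊓ (b ∨ (¬ b))       ≡⟨ cong (a ⊓_) (∨-complementʳ b) ⟩
    a ⊓ ¬ ⊥               ≡⟨ ⊓-identityʳ a ⟩
    a ⊓ a                 ≡⟨ a∈D⊓ ⟩
    a                     ∎

module Interaction (𝔻 : DBA) where
  open DBA 𝔻
  open Properties 𝔻
  private module ᵈ = Properties (dual 𝔻)
  open ≡-Reasoning

  ⊓≡⇒⊔≡⊔-idem : ∀ {a y} → a ⊓ y ≡ a → a ⊔ y ≡ y ⊔ y
  ⊓≡⇒⊔≡⊔-idem {a} {y} a⊓y≡a = begin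
    a ⊔ y         ≡⟨ cong (_⊔ y) a⊓y≡a ⟨
    (a ⊓ y) ⊔ y   ≡⟨ ⊔-comm (a ⊓ y) y ⟩
    y ⊔ (a ⊓ y)   ≡⟨ cong (y ⊔_) (⊓-comm a y) ⟩
    y ⊔ (y ⊓ a)   ≡⟨ ⊔-abs-⊓ y a ⟩
    y ⊔ y         ∎

  -- s = a ∨ b and p = a ⊔ b bound each other: s ⊓ p = s, and p ⊔ s = s ⊔ s because a, b lie below s.
  ∨-⊔-idem : ∀ {a b} → D⊓ 𝔻 a → D⊓ 𝔻 b → (a ∨ b) ⊔ (a ∨ b) ≡ a ⊔ b
  ∨-⊔-idem {a} {b} a∈D⊓ b∈D⊓ = begin
    s ⊔ s   ≡⟨ p⊔s≡s⊔s ⟨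
    p ⊔ s   ≡⟨ ⊔-comm p s ⟩
    s ⊔ p   ≡⟨ ⊓≡⇒⊔≡⊔-idem s⊓p≡s ⟩
    p ⊔ p   ≡⟨ ᵈ.⊓-D⊓ a b ⟩
    p       ∎
    where
    s p : Carrier
    s = a ∨ b
    p = a ⊔ b
    s⊓p≡s : s ⊓ p ≡ s
    s⊓p≡s = begin
      s ⊓ p                     ≡⟨ ⊓-comm s p ⟩
      p ⊓ (a ∨ b)               ≡⟨ ⊓-distr-∨ p a b ⟩
      (p ⊓ a) ∨ (p ⊓ b)         ≡⟨ cong₂ _∨_ (trans (⊓-comm p a) (⊓-abs-⊔ a b))
                                             (trans (⊓-comm p b) (cong (b ⊓_) (⊔-comm a b))) ⟩
      (a ⊓ a) ∨ (b ⊓ (b ⊔ a))   ≡⟨ cong₂ _∨_ a∈D⊓ (trans (⊓-abs-⊔ b a) b∈D⊓) ⟩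
      s                         ∎
    a⊔s≡s⊔s : a ⊔ s ≡ s ⊔ s
    a⊔s≡s⊔s = ⊓≡⇒⊔≡⊔-idem (trans (⊓-abs-∨ a b) a∈D⊓)
    b⊔s≡s⊔s : b ⊔ s ≡ s ⊔ s
    b⊔s≡s⊔s = ⊓≡⇒⊔≡⊔-idem (trans (cong (b ⊓_) (∨-comm a b)) (trans (⊓-abs-∨ b a) b∈D⊓))
    p⊔s≡s⊔s : p ⊔ s ≡ s ⊔ s
    p⊔s≡s⊔s = begin
      (a ⊔ b) ⊔ s   ≡⟨ ⊔-assoc a b s ⟨
      a ⊔ (b ⊔ s)   ≡⟨ cong (a ⊔_) b⊔s≡s⊔s ⟩
      a ⊔ (s ⊔ s)   ≡⟨ ᵈ.⊓-idem-r a s ⟩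
      a ⊔ s         ≡⟨ a⊔s≡s⊔s ⟩
      s ⊔ s         ∎

  ∨-agree⇒⊔-agree : ∀ {x y j} → D⊓ 𝔻 x → D⊓ 𝔻 y → D⊓ 𝔻 j → x ∨ j ≡ y ∨ j → x ⊔ j ≡ y ⊔ j
  ∨-agree⇒⊔-agree {x} {y} {j} x∈D⊓ y∈D⊓ j∈D⊓ e = begin
    x ⊔ j               ≡⟨ ∨-⊔-idem x∈D⊓ j∈D⊓ ⟨
    (x ∨ j) ⊔ (x ∨ j)   ≡⟨ cong (λ z → z ⊔ z) e ⟩
    (y ∨ j) ⊔ (y ∨ j)   ≡⟨ ∨-⊔-idem y∈D⊓ j∈D⊓ ⟩
    y ⊔ j               ∎

  widen-⊔ˡ : ∀ {x y j k} → D⊓ 𝔻 j → D⊓ 𝔻 k → x ⊔ j ≡ y ⊔ j → x ⊔ (j ∨ k) ≡ y ⊔ (j ∨ k)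
  widen-⊔ˡ {x} {y} {j} {k} j∈D⊓ k∈D⊓ e = begin
    x ⊔ (j ∨ k)   ≡⟨ ⊔-∨≡⊔-⊔ x ⟩
    (x ⊔ j) ⊔ k   ≡⟨ cong (_⊔ k) e ⟩
    (y ⊔ j) ⊔ k   ≡⟨ ⊔-∨≡⊔-⊔ y ⟨
    y ⊔ (j ∨ k)   ∎
    where
    ⊔-∨≡⊔-⊔ : ∀ z → z ⊔ (j ∨ k) ≡ (z ⊔ j) ⊔ k
    ⊔-∨≡⊔-⊔ z = begin
      z ⊔ (j ∨ k)               ≡⟨ ᵈ.⊓-idem-r z (j ∨ k) ⟨
      z ⊔ ((j ∨ k) ⊔ (j ∨ k))   ≡⟨ cong (z ⊔_) (∨-⊔-idem j∈D⊓ k∈D⊓) ⟩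
      z ⊔ (j ⊔ k)               ≡⟨ ⊔-assoc z j k ⟩
      (z ⊔ j) ⊔ k               ∎

  widen-⊔ʳ : ∀ {x y j k} → D⊓ 𝔻 j → D⊓ 𝔻 k → x ⊔ k ≡ y ⊔ k → x ⊔ (j ∨ k) ≡ y ⊔ (j ∨ k)
  widen-⊔ʳ {x} {y} {j} {k} j∈D⊓ k∈D⊓ e = begin
    x ⊔ (j ∨ k)   ≡⟨ cong (x ⊔_) (∨-comm j k) ⟩
    x ⊔ (k ∨ j)   ≡⟨ widen-⊔ˡ k∈D⊓ j∈D⊓ e ⟩
    y ⊔ (k ∨ j)   ≡⟨ cong (y ⊔_) (∨-comm k j) ⟩
    y ⊔ (j ∨ k)   ∎

  ⊥-⊔ : ∀ {j} → D⊓ 𝔻 j → ⊥ ⊔ j ≡ j ⊔ j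
  ⊥-⊔ {j} j∈D⊓ = begin
    ⊥ ⊔ j               ≡⟨ ∨-⊔-idem ⊥-D⊓ j∈D⊓ ⟨
    (⊥ ∨ j) ⊔ (⊥ ∨ j)   ≡⟨ cong (λ z → z ⊔ z) (trans (∨-identityˡ j) j∈D⊓) ⟩
    j ⊔ j               ∎

  ⊔-idem-D⊓ : ∀ {x} → D⊓ 𝔻 x → D⊓ 𝔻 (x ⊔ x)
  ⊔-idem-D⊓ {x} x∈D⊓ = sym (begin
    x ⊔ x               ≡⟨ cong₂ _⊔_ x∈D⊓ x∈D⊓ ⟨
    (x ⊓ x) ⊔ (x ⊓ x)   ≡⟨ mixed x ⟩
    (x ⊔ x) ⊓ (x ⊔ x)   ∎)

  D⊓-D⊔-determined : ∀ {x y} → D⊓ 𝔻 x → D⊔ 𝔻 y → x ⊓ x ≡ y ⊓ y → x ⊔ x ≡ y ⊔ y → x ≡ y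
  D⊓-D⊔-determined {x} {y} x∈D⊓ y∈D⊔ e⊓ e⊔ = begin
    x       ≡⟨ x⊔x≡x ⟨
    x ⊔ x   ≡⟨ e⊔ ⟩
    y ⊔ y   ≡⟨ y∈D⊔ ⟩
    y       ∎
    where
    x⊔x≡x : x ⊔ x ≡ x
    x⊔x≡x = begin
      x ⊔ x               ≡⟨ ⊔-idem-D⊓ x∈D⊓ ⟨
      (x ⊔ x) ⊓ (x ⊔ x)   ≡⟨ cong (λ z → z ⊓ z) (trans e⊔ y∈D⊔) ⟩
      y ⊓ y               ≡⟨ e⊓ ⟨
      x ⊓ x               ≡⟨ x∈D⊓ ⟩
      x                   ∎

  pure-determined : Pure 𝔻 → ∀ {x y} → x ⊓ x ≡ y ⊓ y → x ⊔ x ≡ y ⊔ y → x ≡ y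
  pure-determined pure {x} {y} e⊓ e⊔ with pure x | pure y
  ... | inj₁ x∈D⊓ | inj₁ y∈D⊓ = trans (sym x∈D⊓) (trans e⊓ y∈D⊓)
  ... | inj₂ x∈D⊔ | inj₂ y∈D⊔ = trans (sym x∈D⊔) (trans e⊔ y∈D⊔)
  ... | inj₁ x∈D⊓ | inj₂ y∈D⊔ = D⊓-D⊔-determined x∈D⊓ y∈D⊔ e⊓ e⊔
  ... | inj₂ x∈D⊔ | inj₁ y∈D⊓ = sym (D⊓-D⊔-determined y∈D⊓ x∈D⊔ (sym e⊓) (sym e⊔))

  D⊓-is-⊥⇒D⊔ : Pure 𝔻 → D⊓-is-⊥ 𝔻 → ∀ x → D⊔ 𝔻 x
  D⊓-is-⊥⇒D⊔ pure (_ , D⊓⊆⊥) x with pure x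
  ... | inj₂ x∈D⊔ = x∈D⊔
  ... | inj₁ x∈D⊓ = subst (D⊔ 𝔻) (sym (D⊓⊆⊥ x x∈D⊓)) (D⊓⊆⊥ (⊥ ⊔ ⊥) (⊔-idem-D⊓ ⊥-D⊓))

module IdealCongruence (𝔻 : DBA) where
  open DBA 𝔻
  open Properties 𝔻
  open Interaction 𝔻
  private
    module ᵈ = Properties (dual 𝔻)
    module ᵈI = Interaction (dual 𝔻)
  open ≡-Reasoning

  ⊔-agree⇒∨¬⌟-agree : ∀ {p q j} → D⊔ 𝔻 p → D⊔ 𝔻 q → p ⊔ j ≡ q ⊔ j → p ∨ (¬ (⌟ j)) ≡ q ∨ (¬ (⌟ j))
  ⊔-agree⇒∨¬⌟-agree {p} {q} {j} p∈D⊔ q∈D⊔ e = ⊓-agree⇒∨¬-agree (begin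
    p ⊓ ⌟ j                     ≡⟨ ᵈI.∨-⊔-idem p∈D⊔ (ᵈ.¬-D⊓ j) ⟨
    (p ∧ (⌟ j)) ⊓ (p ∧ (⌟ j))   ≡⟨ cong (λ z → z ⊓ z) (ᵈ.⊓-agree⇒∨¬-agree e) ⟩
    (q ∧ (⌟ j)) ⊓ (q ∧ (⌟ j))   ≡⟨ ᵈI.∨-⊔-idem q∈D⊔ (ᵈ.¬-D⊓ j) ⟩
    q ⊓ ⌟ j                     ∎)

  Θ : (Carrier → Set) → Carrier → Carrier → Set
  Θ J x y = Σ Carrier λ j → J j × (x ∨ j ≡ y ∨ j) × (x ⊔ j ≡ y ⊔ j)

  module _ {J : Carrier → Set} (isIdeal : IsIdeal⊓ 𝔻 J) (¬⌟-closed : ∀ a → J a → J (¬ (⌟ a))) where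
    open IsIdeal⊓ isIdeal

    Θ-via-∨ : ∀ {x y j} → D⊓ 𝔻 x → D⊓ 𝔻 y → J j → x ∨ j ≡ y ∨ j → Θ J x y
    Θ-via-∨ x∈D⊓ y∈D⊓ j∈J e = _ , j∈J , e , ∨-agree⇒⊔-agree x∈D⊓ y∈D⊓ (⊆D⊓ _ j∈J) e

    -- Agreement under ⊔ j only yields agreement under ∨ (¬ ⌟ j): this is where J must be ¬⌟-closed.
    Θ-via-⊔ : ∀ {p q j} → D⊔ 𝔻 p → D⊔ 𝔻 q → J j → p ⊔ j ≡ q ⊔ j → Θ J p q
    Θ-via-⊔ {j = j} p∈D⊔ q∈D⊔ j∈J e =
      j ∨ (¬ (⌟ j)) , ∨-closed j (¬ (⌟ j)) j∈J (¬⌟-closed j j∈J) ,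
      widen-∨ʳ (⊔-agree⇒∨¬⌟-agree p∈D⊔ q∈D⊔ e) , widen-⊔ˡ (⊆D⊓ j j∈J) (¬-D⊓ (⌟ j)) e

    Θ-refl : ∀ {x} → Θ J x x
    Θ-refl = ⊥ , ⊥∈ , refl , refl

    Θ-sym : ∀ {x y} → Θ J x y → Θ J y x
    Θ-sym (j , j∈J , e∨ , e⊔) = j , j∈J , sym e∨ , sym e⊔

    Θ-trans : ∀ {x y z} → Θ J x y → Θ J y z → Θ J x z
    Θ-trans (j , j∈J , e∨ , e⊔) (k , k∈J , f∨ , f⊔) =
      j ∨ k , ∨-closed j k j∈J k∈J ,
      trans (widen-∨ˡ e∨) (widen-∨ʳ f∨) ,
      trans (widen-⊔ˡ (⊆D⊓ j j∈J) (⊆D⊓ k k∈J) e⊔) (widen-⊔ʳ (⊆D⊓ j j∈J) (⊆D⊓ k k∈J) f⊔)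

    Θ-⊓ : ∀ {x x′ y y′} → Θ J x x′ → Θ J y y′ → Θ J (x ⊓ y) (x′ ⊓ y′)
    Θ-⊓ {x} {x′} {y} {y′} (j , j∈J , e∨ , _) (k , k∈J , f∨ , _) =
      Θ-via-∨ (⊓-D⊓ x y) (⊓-D⊓ x′ y′) (∨-closed j k j∈J k∈J) (∨-resp-⊓ (widen-∨ˡ e∨) (widen-∨ʳ f∨))

    Θ-¬ : ∀ {x y} → Θ J x y → Θ J (¬ x) (¬ y)
    Θ-¬ {x} {y} (j , j∈J , e∨ , _) = Θ-via-∨ (¬-D⊓ x) (¬-D⊓ y) j∈J (∨-resp-¬ e∨)

    Θ-⊔ : ∀ {x x′ y y′} → Θ J x x′ → Θ J y y′ → Θ J (x ⊔ y) (x′ ⊔ y′)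
    Θ-⊔ {x} {x′} {y} {y′} (j , j∈J , _ , e⊔) (k , k∈J , _ , f⊔) =
      Θ-via-⊔ (ᵈ.⊓-D⊓ x y) (ᵈ.⊓-D⊓ x′ y′) (∨-closed j k j∈J k∈J) (begin
        (x ⊔ y) ⊔ (j ∨ k)                 ≡⟨ ᵈ.⊓-distribʳ-⊓ x y (j ∨ k) ⟩
        (x ⊔ (j ∨ k)) ⊔ (y ⊔ (j ∨ k))     ≡⟨ cong₂ _⊔_ (widen-⊔ˡ j∈D⊓ k∈D⊓ e⊔) (widen-⊔ʳ j∈D⊓ k∈D⊓ f⊔) ⟩
        (x′ ⊔ (j ∨ k)) ⊔ (y′ ⊔ (j ∨ k))   ≡⟨ ᵈ.⊓-distribʳ-⊓ x′ y′ (j ∨ k) ⟨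
        (x′ ⊔ y′) ⊔ (j ∨ k)               ∎)
      where
      j∈D⊓ : D⊓ 𝔻 j
      j∈D⊓ = ⊆D⊓ j j∈J
      k∈D⊓ : D⊓ 𝔻 k
      k∈D⊓ = ⊆D⊓ k k∈J

    Θ-⌟ : ∀ {x y} → Θ J x y → Θ J (⌟ x) (⌟ y)
    Θ-⌟ {x} {y} (j , j∈J , _ , e⊔) = Θ-via-⊔ (ᵈ.¬-D⊓ x) (ᵈ.¬-D⊓ y) j∈J (ᵈ.⊓-resp-¬ e⊔)

    Θ-isCongruence : IsCongruence 𝔻 (Θ J)
    Θ-isCongruence = record
      { refl = Θ-refl ; sym = Θ-sym ; trans = Θ-trans
      ; ⊓-cong = Θ-⊓ ; ⊔-cong = Θ-⊔ ; ¬-cong = Θ-¬ ; ⌟-cong = Θ-⌟ }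

    Θ-⊥ : ∀ {j} → J j → Θ J j ⊥
    Θ-⊥ {j} j∈J = j , j∈J , trans (∨-idem j) (sym (∨-identityˡ j)) , sym (⊥-⊔ (⊆D⊓ j j∈J))

    Θ-⊥⇒∈ : ∀ {a} → D⊓ 𝔻 a → Θ J a ⊥ → J a
    Θ-⊥⇒∈ {a} a∈D⊓ (j , j∈J , e∨ , _) = downward j a j∈J a∈D⊓ (begin
      a ⊓ j         ≡⟨ cong (a ⊓_) (trans e∨ (trans (∨-identityˡ j) (⊆D⊓ j j∈J))) ⟨
      a ⊓ (a ∨ j)   ≡⟨ ⊓-abs-∨ a j ⟩
      a ⊓ a         ≡⟨ a∈D⊓ ⟩
      a             ∎)

    Θ-⊤⊥⇒⊤∈D⊓ : Θ J ⊤ ⊥ → D⊓ 𝔻 ⊤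
    Θ-⊤⊥⇒⊤∈D⊓ (j , j∈J , _ , e⊔) = subst (D⊓ 𝔻) (sym ⊤≡j⊔j) (⊔-idem-D⊓ j∈D⊓)
      where
      j∈D⊓ : D⊓ 𝔻 j
      j∈D⊓ = ⊆D⊓ j j∈J
      ⊤≡j⊔j : ⊤ ≡ j ⊔ j
      ⊤≡j⊔j = begin
        ⊤       ≡⟨ ᵈ.⊓-zeroʳ j ⟨
        j ⊔ ⊤   ≡⟨ ⊔-comm j ⊤ ⟩
        ⊤ ⊔ j   ≡⟨ e⊔ ⟩
        ⊥ ⊔ j   ≡⟨ ⊥-⊔ j∈D⊓ ⟩
        j ⊔ j   ∎

  simple⇒onlyTrivialIdeals : Simple 𝔻 → OnlyTrivialIdeals 𝔻
  simple⇒onlyTrivialIdeals simple J isIdeal ¬⌟-closed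
    with simple (Θ J) (Θ-isCongruence isIdeal ¬⌟-closed)
  ... | inj₁ Θ⊆≡ = inj₁ λ x x∈J → Θ⊆≡ x ⊥ (Θ-⊥ isIdeal ¬⌟-closed x∈J)
  ... | inj₂ Θ-total = inj₂ λ x x∈D⊓ → Θ-⊥⇒∈ isIdeal ¬⌟-closed x∈D⊓ (Θ-total x ⊥)

module Duality (𝔻 : DBA) where
  open DBA 𝔻
  private module ᵈ = Properties (dual 𝔻)

  congruence-to-dual : ∀ {θ} → IsCongruence 𝔻 θ → IsCongruence (dual 𝔻) θ
  congruence-to-dual isCong = record
    { refl = C.refl ; sym = C.sym ; trans = C.trans
    ; ⊓-cong = C.⊔-cong ; ⊔-cong = C.⊓-cong ; ¬-cong = C.⌟-cong ; ⌟-cong = C.¬-cong }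
    where module C = IsCongruence isCong

  congruence-from-dual : ∀ {θ} → IsCongruence (dual 𝔻) θ → IsCongruence 𝔻 θ
  congruence-from-dual isCong = record
    { refl = C.refl ; sym = C.sym ; trans = C.trans
    ; ⊓-cong = C.⊔-cong ; ⊔-cong = C.⊓-cong ; ¬-cong = C.⌟-cong ; ⌟-cong = C.¬-cong }
    where module C = IsCongruence isCong

  simple-dual : Simple 𝔻 → Simple (dual 𝔻)
  simple-dual simple θ isCong = simple θ (congruence-from-dual isCong)

  dual-simple : Simple (dual 𝔻) → Simple 𝔻
  dual-simple simple θ isCong = simple θ (congruence-to-dual isCong)

  pure-dual : Pure 𝔻 → Pure (dual 𝔻)
  pure-dual pure x = swap (pure x)

  filter⇒dual-ideal : ∀ {F} → IsFilter⊔ 𝔻 F → IsIdeal⊓ (dual 𝔻) F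
  filter⇒dual-ideal isFilter = record
    { ⊆D⊓ = ⊆D⊔ ; ⊥∈ = ⊤∈ ; ∨-closed = ∧-closed
    ; downward = λ x y x∈F y∈D⊔ e → upward x y x∈F y∈D⊔ (trans (⊔-comm x y) e) }
    where open IsFilter⊔ isFilter

  dual-ideal⇒filter : ∀ {F} → IsIdeal⊓ (dual 𝔻) F → IsFilter⊔ 𝔻 F
  dual-ideal⇒filter isIdeal = record
    { ⊆D⊔ = ⊆D⊓ ; ⊤∈ = ⊥∈ ; ∧-closed = ∨-closed
    ; upward = λ x y x∈F y∈D⊔ e → downward x y x∈F y∈D⊔ (trans (⊔-comm y x) e) }
    where open IsIdeal⊓ isIdeal

  simple⇒onlyTrivialFilters : Simple 𝔻 → OnlyTrivialFilters 𝔻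
  simple⇒onlyTrivialFilters simple F isFilter =
    IdealCongruence.simple⇒onlyTrivialIdeals (dual 𝔻) (simple-dual simple) F (filter⇒dual-ideal isFilter)

  dual-cond2⇒cond3 : Cond2 (dual 𝔻) → Cond3 𝔻
  dual-cond2⇒cond3 (inj₁ degenerate) = inj₁ degenerate
  dual-cond2⇒cond3 (inj₂ (⊥∈D⊔ , onlyTrivial)) =
    inj₂ (⊥∈D⊔ , λ F isFilter → onlyTrivial F (filter⇒dual-ideal isFilter))

  cond3⇒dual-cond2 : Cond3 𝔻 → Cond2 (dual 𝔻)
  cond3⇒dual-cond2 (inj₁ degenerate) = inj₁ degenerate
  cond3⇒dual-cond2 (inj₂ (⊥∈D⊔ , onlyTrivial)) =
    inj₂ (⊥∈D⊔ , λ F isIdeal → onlyTrivial F (dual-ideal⇒filter isIdeal))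

  ↑ : Carrier → Carrier → Set
  ↑ b c = D⊔ 𝔻 c × b ⊔ c ≡ c

  ↑-isFilter : ∀ b → IsFilter⊔ 𝔻 (↑ b)
  ↑-isFilter b = record
    { ⊆D⊔ = λ _ → proj₁
    ; ⊤∈ = ᵈ.⊥-D⊓ , ᵈ.⊓-zeroʳ b
    ; ∧-closed = λ x y (_ , b⊔x≡x) (_ , b⊔y≡y) →
        ᵈ.∨-D⊓ x y , trans (⊔-distr-∧ b x y) (cong₂ _∧_ b⊔x≡x b⊔y≡y)
    ; upward = λ x y (_ , b⊔x≡x) y∈D⊔ x⊔y≡y → y∈D⊔ , (begin
        b ⊔ y         ≡⟨ cong (b ⊔_) x⊔y≡y ⟨
        b ⊔ (x ⊔ y)   ≡⟨ ⊔-assoc b x y ⟩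
        (b ⊔ x) ⊔ y   ≡⟨ cong (_⊔ y) b⊔x≡x ⟩
        x ⊔ y         ≡⟨ x⊔y≡y ⟩
        y             ∎) }
    where open ≡-Reasoning

module Kernel (𝔻 : DBA) {θ : DBA.Carrier 𝔻 → DBA.Carrier 𝔻 → Set} (isCong : IsCongruence 𝔻 θ) where
  open DBA 𝔻
  open Properties 𝔻
  open Interaction 𝔻
  open IsCongruence isCong renaming (refl to θ-refl; sym to θ-sym; trans to θ-trans)
  private module ᵈ = Properties (dual 𝔻)
  open ≡-Reasoning

  kernel : Carrier → Set
  kernel x = D⊓ 𝔻 x × θ x ⊥

  kernel-isIdeal : IsIdeal⊓ 𝔻 kernel
  kernel-isIdeal = record
    { ⊆D⊓ = λ _ → proj₁
    ; ⊥∈ = ⊥-D⊓ , θ-refl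
    ; ∨-closed = λ x y (_ , xθ⊥) (_ , yθ⊥) →
        ∨-D⊓ x y , subst (θ (x ∨ y)) (trans (∨-idem ⊥) ⊥-D⊓) (¬-cong (⊓-cong (¬-cong xθ⊥) (¬-cong yθ⊥)))
    ; downward = λ x y (_ , xθ⊥) y∈D⊓ y⊓x≡y → y∈D⊓ , subst₂ θ y⊓x≡y (⊓-zeroʳ y) (⊓-cong θ-refl xθ⊥) }

  kernel-¬⌟-closed : ∀ a → kernel a → kernel (¬ (⌟ a))
  kernel-¬⌟-closed a (_ , aθ⊥) = ¬-D⊓ (⌟ a) , subst (θ (¬ (⌟ a))) (trans (cong ¬_ ⌟⊥) ¬⊤) (¬-cong (⌟-cong aθ⊥))

  kernel-full⇒total : Pure 𝔻 → D⊓ 𝔻 ⊤ → (∀ x → D⊓ 𝔻 x → kernel x) → ∀ x y → θ x y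
  kernel-full⇒total pure ⊤∈D⊓ full x y = θ-trans (θ⊥ x) (θ-sym (θ⊥ y))
    where
    ⊤θ⊥ : θ ⊤ ⊥
    ⊤θ⊥ = proj₂ (full ⊤ ⊤∈D⊓)
    θ⊥ : ∀ x → θ x ⊥
    θ⊥ x with pure x
    ... | inj₁ x∈D⊓ = proj₂ (full x x∈D⊓)
    ... | inj₂ x∈D⊔ = θ-trans (θ-sym (subst₂ θ (ᵈ.⊓-zeroʳ x) x⊔⊥≡x (⊔-cong θ-refl ⊤θ⊥))) ⊤θ⊥
      where
      x⊔⊥≡x : x ⊔ ⊥ ≡ x
      x⊔⊥≡x = begin
        x ⊔ ⊥         ≡⟨ ᵈ.⊓-idem-r x ⊥ ⟨
        x ⊔ (⊥ ⊔ ⊥)   ≡⟨ cong (x ⊔_) ⌟⊤ ⟨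
        x ⊔ ⌟ ⊤       ≡⟨ ᵈ.⊓-identityʳ x ⟩
        x ⊔ x         ≡⟨ x∈D⊔ ⟩
        x             ∎

  module _ (trivial : ∀ x → kernel x → x ≡ ⊥) where

    θ-D⊓-≤ : ∀ {a b} → D⊓ 𝔻 a → θ a b → a ⊓ b ≡ a
    θ-D⊓-≤ {a} {b} a∈D⊓ aθb = ⊓¬≡⊥⇒⊓≡ a∈D⊓ (trivial (a ⊓ (¬ b))
      (⊓-D⊓ a (¬ b) , subst (θ (a ⊓ (¬ b))) (⊓-compl b) (⊓-cong aθb θ-refl)))

    θ-D⊓-injective : ∀ {a b} → D⊓ 𝔻 a → D⊓ 𝔻 b → θ a b → a ≡ b
    θ-D⊓-injective {a} {b} a∈D⊓ b∈D⊓ aθb = begin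
      a       ≡⟨ θ-D⊓-≤ a∈D⊓ aθb ⟨
      a ⊓ b   ≡⟨ ⊓-comm a b ⟩
      b ⊓ a   ≡⟨ θ-D⊓-≤ b∈D⊓ (θ-sym aθb) ⟩
      b       ∎

    θ⊤⇒≡⊤ : ⊤ ⊓ ⊤ ≡ ⊤ → ∀ {b} → D⊔ 𝔻 b → θ b ⊤ → b ≡ ⊤
    θ⊤⇒≡⊤ ⊤∈D⊓ {b} b∈D⊔ bθ⊤ = begin
      b             ≡⟨ b∈D⊔ ⟨
      b ⊔ b         ≡⟨ ⊔-abs-⊓ b b ⟨
      b ⊔ (b ⊓ b)   ≡⟨ cong (b ⊔_) b⊓b≡⊤ ⟩
      b ⊔ ⊤         ≡⟨ ᵈ.⊓-zeroʳ b ⟩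
      ⊤             ∎
      where
      ¬b≡⊥ : ¬ b ≡ ⊥
      ¬b≡⊥ = trivial (¬ b) (¬-D⊓ b , subst (θ (¬ b)) ¬⊤ (¬-cong bθ⊤))
      b⊓b≡⊤ : b ⊓ b ≡ ⊤
      b⊓b≡⊤ = trans (sym (¬¬x≡x⊓x b)) (trans (cong ¬_ ¬b≡⊥) (trans ¬⊥ ⊤∈D⊓))

    θ-D⊔-≤ : ⊤ ⊓ ⊤ ≡ ⊤ → ∀ {a b} → D⊔ 𝔻 a → θ a b → a ⊔ b ≡ a
    θ-D⊔-≤ ⊤∈D⊓ {a} {b} a∈D⊔ aθb = ᵈ.⊓¬≡⊥⇒⊓≡ a∈D⊔ (θ⊤⇒≡⊤ ⊤∈D⊓ (ᵈ.⊓-D⊓ a (⌟ b))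
      (subst (θ (a ⊔ (⌟ b))) (⊔-compl b) (⊔-cong aθb θ-refl)))

    θ-D⊔-injective : ⊤ ⊓ ⊤ ≡ ⊤ → ∀ {a b} → D⊔ 𝔻 a → D⊔ 𝔻 b → θ a b → a ≡ b
    θ-D⊔-injective ⊤∈D⊓ {a} {b} a∈D⊔ b∈D⊔ aθb = begin
      a       ≡⟨ θ-D⊔-≤ ⊤∈D⊓ a∈D⊔ aθb ⟨
      a ⊔ b   ≡⟨ ⊔-comm a b ⟩
      b ⊔ a   ≡⟨ θ-D⊔-≤ ⊤∈D⊓ b∈D⊔ (θ-sym aθb) ⟩
      b       ∎

    kernel-trivial⇒θ⊆≡ : Pure 𝔻 → ⊤ ⊓ ⊤ ≡ ⊤ → ∀ x y → θ x y → x ≡ y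
    kernel-trivial⇒θ⊆≡ pure ⊤∈D⊓ x y xθy = pure-determined pure
      (θ-D⊓-injective (⊓-D⊓ x x) (⊓-D⊓ y y) (⊓-cong xθy xθy))
      (θ-D⊔-injective ⊤∈D⊓ (ᵈ.⊓-D⊓ x x) (ᵈ.⊓-D⊓ y y) (⊔-cong xθy xθy))

  kernel-dichotomy⇒dichotomy : Pure 𝔻 → ⊤ ⊓ ⊤ ≡ ⊤ →
    (∀ x → kernel x → x ≡ ⊥) ⊎ (∀ x → D⊓ 𝔻 x → kernel x) →
    (∀ x y → θ x y → x ≡ y) ⊎ (∀ x y → θ x y)
  kernel-dichotomy⇒dichotomy pure ⊤∈D⊓ =
    Sum.map (λ trivial → kernel-trivial⇒θ⊆≡ trivial pure ⊤∈D⊓) (kernel-full⇒total pure ⊤∈D⊓)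

atMostTwo-dichotomy : ∀ {A : Set} {a b : A} (θ : A → A → Set) → (∀ x → x ≡ a ⊎ x ≡ b) →
  (∀ {x} → θ x x) → (∀ {x y} → θ x y → θ y x) → Dec (θ a b) →
  (∀ x y → θ x y → x ≡ y) ⊎ (∀ x y → θ x y)
atMostTwo-dichotomy {a = a} {b} θ two θ-refl θ-sym (yes aθb) = inj₂ λ x y → related (two x) (two y)
  where
  related : ∀ {x y} → x ≡ a ⊎ x ≡ b → y ≡ a ⊎ y ≡ b → θ x y
  related (inj₁ refl) (inj₁ refl) = θ-refl
  related (inj₁ refl) (inj₂ refl) = aθb
  related (inj₂ refl) (inj₁ refl) = θ-sym aθb
  related (inj₂ refl) (inj₂ refl) = θ-refl
atMostTwo-dichotomy {a = a} {b} θ two θ-refl θ-sym (no ¬aθb) = inj₁ λ x y → equal (two x) (two y)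
  where
  equal : ∀ {x y} → x ≡ a ⊎ x ≡ b → y ≡ a ⊎ y ≡ b → θ x y → x ≡ y
  equal (inj₁ refl) (inj₁ refl) _   = refl
  equal (inj₁ refl) (inj₂ refl) aθb = contradiction aθb ¬aθb
  equal (inj₂ refl) (inj₁ refl) bθa = contradiction (θ-sym bθa) ¬aθb
  equal (inj₂ refl) (inj₂ refl) _   = refl

module Degenerate (𝔻 : DBA) where
  open DBA 𝔻
  open Properties 𝔻
  open IdealCongruence 𝔻
  open Duality 𝔻
  private module ᵈ = Properties (dual 𝔻)
  open ≡-Reasoning

  D⊓-isIdeal : IsIdeal⊓ 𝔻 (D⊓ 𝔻)
  D⊓-isIdeal = record
    { ⊆D⊓ = λ _ x∈D⊓ → x∈D⊓ ; ⊥∈ = ⊥-D⊓ ; ∨-closed = λ x y _ _ → ∨-D⊓ x y ; downward = λ _ _ _ y∈D⊓ _ → y∈D⊓ }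

  D⊓-¬⌟-closed : ∀ a → D⊓ 𝔻 a → D⊓ 𝔻 (¬ (⌟ a))
  D⊓-¬⌟-closed a _ = ¬-D⊓ (⌟ a)

  simple⇒D⊓-is-⊥ : Simple 𝔻 → ⊤ ⊓ ⊤ ≢ ⊤ → D⊓-is-⊥ 𝔻
  simple⇒D⊓-is-⊥ simple ⊤∉D⊓ with simple (Θ (D⊓ 𝔻)) (Θ-isCongruence D⊓-isIdeal D⊓-¬⌟-closed)
  ... | inj₁ Θ⊆≡ = ⊥-D⊓ , λ x x∈D⊓ → Θ⊆≡ x ⊥ (Θ-⊥ D⊓-isIdeal D⊓-¬⌟-closed x∈D⊓)
  ... | inj₂ Θ-total = contradiction (Θ-⊤⊥⇒⊤∈D⊓ D⊓-isIdeal D⊓-¬⌟-closed (Θ-total ⊤ ⊥)) ⊤∉D⊓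

  simple⇒D⊔-atMost2 : Simple 𝔻 → D⊓-is-⊥ 𝔻 → D⊔-atMost2 𝔻
  simple⇒D⊔-atMost2 simple (_ , D⊓⊆⊥) = ⊤ , ⊥ ⊔ ⊥ , classify
    where
    ⌟¬-closed : ∀ b a → ↑ b a → ↑ b (⌟ (¬ a))
    ⌟¬-closed b a _ = subst (↑ b) (trans (sym ⌟⊥) (cong ⌟_ (sym (D⊓⊆⊥ (¬ a) (¬-D⊓ a)))))
                        (IsFilter⊔.⊤∈ (↑-isFilter b))
    classify : ∀ b → D⊔ 𝔻 b → b ≡ ⊤ ⊎ b ≡ ⊥ ⊔ ⊥
    classify b b∈D⊔ with simple⇒onlyTrivialFilters simple (↑ b) (↑-isFilter b) (⌟¬-closed b)
    ... | inj₁ ↑b⊆⊤ = inj₁ (↑b⊆⊤ b (b∈D⊔ , b∈D⊔))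
    ... | inj₂ ↑b-full = inj₂ (begin
      b             ≡⟨ b∈D⊔ ⟨
      b ⊔ b         ≡⟨ ᵈ.⊓-identityʳ b ⟨
      b ⊔ ⌟ ⊤       ≡⟨ cong (b ⊔_) ⌟⊤ ⟩
      b ⊔ (⊥ ⊔ ⊥)   ≡⟨ proj₂ (↑b-full (⊥ ⊔ ⊥) (ᵈ.⊓-D⊓ ⊥ ⊥)) ⟩
      ⊥ ⊔ ⊥         ∎)

module Classical (lem : ExcludedMiddle 0ℓ) (𝔻 : DBA) where
  open DBA 𝔻
  open Interaction 𝔻
  open IdealCongruence 𝔻
  open Degenerate 𝔻

  simple⇒cond2 : Simple 𝔻 → Cond2 𝔻
  simple⇒cond2 simple with lem {⊤ ⊓ ⊤ ≡ ⊤}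
  ... | yes ⊤∈D⊓ = inj₂ (⊤∈D⊓ , simple⇒onlyTrivialIdeals simple)
  ... | no ⊤∉D⊓ = inj₁ (D⊓≡⊥ , simple⇒D⊔-atMost2 simple D⊓≡⊥)
    where
    D⊓≡⊥ : D⊓-is-⊥ 𝔻
    D⊓≡⊥ = simple⇒D⊓-is-⊥ simple ⊤∉D⊓

  cond2⇒simple : Pure 𝔻 → Cond2 𝔻 → Simple 𝔻
  cond2⇒simple pure (inj₁ (D⊓≡⊥ , (_ , _ , two))) θ isCong =
    atMostTwo-dichotomy θ (λ x → two x (D⊓-is-⊥⇒D⊔ pure D⊓≡⊥ x)) C.refl C.sym lem
    where module C = IsCongruence isCong
  cond2⇒simple pure (inj₂ (⊤∈D⊓ , onlyTrivial)) θ isCong =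
    K.kernel-dichotomy⇒dichotomy pure ⊤∈D⊓ (onlyTrivial K.kernel K.kernel-isIdeal K.kernel-¬⌟-closed)
    where module K = Kernel 𝔻 isCong

-- Excluded middle at level 0 suffices.
proposition3p16 : ExcludedMiddle 0ℓ → ExcludedMiddle (lsuc 0ℓ) →
    (𝔻 : DBA) → Pure 𝔻 →
    ((Simple 𝔻 ⇔ Cond2 𝔻) × (Simple 𝔻 ⇔ Cond3 𝔻))
proposition3p16 lem _ 𝔻 pure =
  mk⇔ C.simple⇒cond2 (C.cond2⇒simple pure) ,
  mk⇔ (λ simple → D.dual-cond2⇒cond3 (Cᵈ.simple⇒cond2 (D.simple-dual simple)))
      (λ cond3 → D.dual-simple (Cᵈ.cond2⇒simple (D.pure-dual pure) (D.cond3⇒dual-cond2 cond3)))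
  where
  module C = Classical lem 𝔻
  module Cᵈ = Classical lem (dual 𝔻)
  module D = Duality 𝔻
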